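{- Let $G$ be a connected graph of order $n\ge 2$ and let $H$ be a non-trivial graph. If there exists an adjacency basis for $H$ which is also a dominating set of $H$, and if for every adjacency basis $S$ for $H$ there exists $v\in V(H)\setminus S$ such that $S\subseteq N_H(v)$, then $$\operatorname{dim}_A(G\odot H)=n\cdot \operatorname{dim}_A(H)+\gamma(G).$$
   Context: All graphs are finite, simple, undirected; non-trivial means order at least 2. A set $S\subseteq V(H)$ is an adjacency generator for $H$ if for every two distinct $x,y\in V(H)\setminus S$ there exists $s\in S$ with $|N_H(s)\cap\{x,y\}|=1$ ($N_H$ the open neighbourhood); an adjacency basis is an adjacency generator of minimum cardinality, and this cardinality is $\operatorname{dim}_A(H)$. A dominating set $D$ of a graph satisfies $\bigcup_{v\in D}N[v]=V$; $\gamma(G)$ is the minimum size of a dominating set of $G$. The corona product $G\odot H$ ($G$ of order $n$ with vertices $v_1,\dots,v_n$) consists of $G$ and $n$ disjoint copies $H_1,\dots,H_n$ of $H$, with $v_i$ joined to every vertex of $H_i$. -}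

module Defs where

open import Data.Nat using (ℕ; _+_; _*_; _≤_)
open import Data.Bool using (Bool; true; false; _∧_)
open import Data.Fin using (Fin; splitAt; remQuot; _≟_)
open import Data.Fin.Subset using (Subset; _∈_; _∉_; ∣_∣)
open import Data.Sum using (_⊎_; inj₁; inj₂)
open import Data.Product using (Σ; _×_; _,_; ∃)
open import Relation.Nullary using (¬_)
open import Relation.Nullary.Decidable using (⌊_⌋)
open import Relation.Binary.PropositionalEquality using (_≡_; _≢_)

record Graph : Set where
  field
    order : ℕ
    adj   : Fin order → Fin order → Bool
open Graph public

Vertex : Graph → Set
Vertex G = Fin (order G)

Edge : (G : Graph) → Vertex G → Vertex G → Set
Edge G u v = adj G u v ≡ true

IsSimple : Graph → Set
IsSimple G = (∀ u v → adj G u v ≡ adj G v u) × (∀ v → adj G v v ≡ false)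

data Reachable (G : Graph) : Vertex G → Vertex G → Set where
  here : ∀ {u} → Reachable G u u
  step : ∀ {u v w} → Edge G u v → Reachable G v w → Reachable G u w

Connected : Graph → Set
Connected G = ∀ u v → Reachable G u v

-- open neighbourhood: s distinguishes x and y iff exactly one of x,y is adjacent to s
IsAdjGen : (G : Graph) → Subset (order G) → Set
IsAdjGen G S = ∀ x y → x ≢ y → x ∉ S → y ∉ S →
  ∃ λ s → s ∈ S × (adj G s x ≢ adj G s y)

IsAdjBasis : (G : Graph) → Subset (order G) → Set
IsAdjBasis G S = IsAdjGen G S × (∀ T → IsAdjGen G T → ∣ S ∣ ≤ ∣ T ∣)

IsAdjDim : Graph → ℕ → Set
IsAdjDim G k = Σ (Subset (order G)) (λ S → IsAdjBasis G S × ∣ S ∣ ≡ k)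

IsDominating : (G : Graph) → Subset (order G) → Set
IsDominating G D = ∀ v → v ∈ D ⊎ (∃ λ u → u ∈ D × Edge G u v)

IsDomNumber : Graph → ℕ → Set
IsDomNumber G k =
  (Σ (Subset (order G)) (λ D → IsDominating G D × ∣ D ∣ ≡ k)) ×
  (∀ D → IsDominating G D → k ≤ ∣ D ∣)

-- corona product G ⊙ H: vertices Fin (n + n * m); the first n are G's vertices,
-- the remaining ones are pairs (i , x) = vertex x of copy H_i.
corona : Graph → Graph → Graph
corona G H = record { order = n + n * m ; adj = a }
  where
  n = order G
  m = order H
  dec : Fin (n + n * m) → Fin n ⊎ (Fin n × Fin m)
  dec v with splitAt n v
  ... | inj₁ i = inj₁ i
  ... | inj₂ p = inj₂ (remQuot {n} m p)
  a' : Fin n ⊎ (Fin n × Fin m) → Fin n ⊎ (Fin n × Fin m) → Bool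
  a' (inj₁ i) (inj₁ j) = adj G i j
  a' (inj₁ i) (inj₂ (j , y)) = ⌊ i ≟ j ⌋
  a' (inj₂ (i , x)) (inj₁ j) = ⌊ i ≟ j ⌋
  a' (inj₂ (i , x)) (inj₂ (j , y)) = ⌊ i ≟ j ⌋ ∧ adj H x y
  a : Fin (n + n * m) → Fin (n + n * m) → Bool
  a u v = a' (dec u) (dec v)

-- Write the vertices of G ⊙ H as Vtx = Fin n ⊎ (Fin n × Fin m): a vertex v_i of
-- G, or the vertex x of the i-th copy H_i.
--
-- Upper bound: for a dominating adjacency basis B of H and a minimum dominating
-- set D of G, the set D ∪ ⋃ᵢ Bᵢ resolves G ⊙ H and has n·|B| + |D| elements.
-- Lower bound: for any adjacency generator T of G ⊙ H, each copy-part Tᵢ is an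
-- adjacency generator of H, so |Tᵢ| ≥ d.  The vertices v_i that lie in T, or
-- whose copy carries more than d vertices of T, dominate G: a remaining v_i has
-- a basis Tᵢ, hence a vertex z of H_i adjacent to all of Tᵢ, and only a
-- G-neighbour v_j ∈ T can distinguish v_i from z.  Counting gives
-- γ(G) ≤ |T ∩ G| + Σᵢ (|Tᵢ| − d), i.e. n·d + γ(G) ≤ |T|.
module Submission where

open import Defs
import Algebra.Properties.CommutativeMonoid.Sum
open import Algebra.Properties.CommutativeSemigroup using (x∙yz≈y∙xz)
open import Data.Bool using (Bool; true; false; _∧_; _∨_)
open import Data.Bool.Properties using (¬-not; ∨-zeroʳ)
open import Data.Empty using (⊥-elim)
open import Data.Fin using (Fin; splitAt; remQuot; combine; join; _↑ˡ_; _↑ʳ_; fromℕ<; _≟_)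
  renaming (zero to fzero; suc to fsuc)
open import Data.Fin.Properties using (splitAt-↑ˡ; splitAt-↑ʳ; remQuot-combine; combine-remQuot; join-splitAt)
open import Data.Fin.Subset using (Subset; _∈_; _∉_; ∣_∣)
open import Data.Nat using (ℕ; zero; suc; _+_; _*_; _∸_; _≤_; _<_; z≤n; s≤s; _<?_)
open import Data.Nat.Properties
  using (+-assoc; +-comm; +-mono-≤; +-monoʳ-≤; ≤-trans; ≤-antisym; ≮⇒≥; m<n⇒0<n∸m; m+[n∸m]≡n;
         +-0-commutativeMonoid; +-commutativeSemigroup; module ≤-Reasoning)
open import Data.Product using (Σ; _×_; _,_; ∃; proj₁; proj₂)
open import Data.Sum using (_⊎_; inj₁; inj₂; [_,_]′)
open import Data.Vec using ([]; _∷_; lookup; tabulate)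
open import Data.Vec.Properties using (lookup∘tabulate; []=⇒lookup; lookup⇒[]=)
open import Function using (_∘_)
open import Relation.Binary.PropositionalEquality
open import Relation.Nullary using (Dec; yes; no; ¬_)
open import Relation.Nullary.Decidable using (⌊_⌋; dec-true; dec-false; isYes≗does)

open Algebra.Properties.CommutativeMonoid.Sum +-0-commutativeMonoid
  using (sum; sum-syntax; sum-cong-≗; ∑-distrib-+)

true≢false : ∀ {a b : Bool} → a ≡ true → b ≡ false → a ≢ b
true≢false refl refl ()

false≢true : ∀ {a b : Bool} → a ≡ false → b ≡ true → a ≢ b
false≢true a≡false b≡true = ≢-sym (true≢false b≡true a≡false)

true⇒∈ : ∀ {k} {S : Subset k} {i} → lookup S i ≡ true → i ∈ S
true⇒∈ {S = S} {i} = lookup⇒[]= i S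

∉⇒false : ∀ {k} {S : Subset k} {i} → i ∉ S → lookup S i ≡ false
∉⇒false i∉S = ¬-not (i∉S ∘ true⇒∈)

false⇒∉ : ∀ {k} {S : Subset k} {i} → lookup S i ≡ false → i ∉ S
false⇒∉ i↦false i∈S = true≢false ([]=⇒lookup i∈S) i↦false refl

holds : ∀ {A : Set} (a? : Dec A) → A → ⌊ a? ⌋ ≡ true
holds a? a = trans (isYes≗does a?) (dec-true a? a)

fails : ∀ {A : Set} (a? : Dec A) → ¬ A → ⌊ a? ⌋ ≡ false
fails a? ¬a = trans (isYes≗does a?) (dec-false a? ¬a)

indicator : Bool → ℕ
indicator true  = 1
indicator false = 0

count : ∀ {k} → (Fin k → Bool) → ℕ
count {k} f = ∑[ i < k ] indicator (f i)

count-cong : ∀ {k} {f g : Fin k → Bool} → (∀ i → f i ≡ g i) → count f ≡ count g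
count-cong f≗g = sum-cong-≗ (cong indicator ∘ f≗g)

size-as-count : ∀ {k} (S : Subset k) → ∣ S ∣ ≡ count (lookup S)
size-as-count []          = refl
size-as-count (true ∷ S)  = cong suc (size-as-count S)
size-as-count (false ∷ S) = size-as-count S

size-tabulate : ∀ {k} (f : Fin k → Bool) → ∣ tabulate f ∣ ≡ count f
size-tabulate f = trans (size-as-count (tabulate f)) (count-cong (lookup∘tabulate f))

sum-↑ : ∀ a {b} (f : Fin (a + b) → ℕ) →
  sum f ≡ ∑[ i < a ] f (i ↑ˡ b) + ∑[ j < b ] f (a ↑ʳ j)
sum-↑ zero    f = refl
sum-↑ (suc a) f = trans (cong (f fzero +_) (sum-↑ a (f ∘ fsuc))) (sym (+-assoc (f fzero) _ _))

sum-combine : ∀ n {m} (f : Fin (n * m) → ℕ) →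
  sum f ≡ ∑[ i < n ] ∑[ x < m ] f (combine i x)
sum-combine zero    f = refl
sum-combine (suc n) {m} f =
  trans (sum-↑ m f) (cong (∑[ x < m ] f (x ↑ˡ (n * m)) +_) (sum-combine n (f ∘ (m ↑ʳ_))))

sum-const : ∀ n c → ∑[ i < n ] c ≡ n * c
sum-const zero    c = refl
sum-const (suc n) c = cong (c +_) (sum-const n c)

sum-mono : ∀ {k} {f g : Fin k → ℕ} → (∀ i → f i ≤ g i) → sum f ≤ sum g
sum-mono {zero}  f≤g = z≤n
sum-mono {suc k} f≤g = +-mono-≤ (f≤g fzero) (sum-mono (f≤g ∘ fsuc))

sum-excess : ∀ {k} c (f : Fin k → ℕ) → (∀ i → c ≤ f i) →
  k * c + ∑[ i < k ] (f i ∸ c) ≡ sum f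
sum-excess {k} c f c≤f = begin
  k * c + ∑[ i < k ] (f i ∸ c)          ≡⟨ cong (_+ ∑[ i < k ] (f i ∸ c)) (sum-const k c) ⟨
  ∑[ i < k ] c + ∑[ i < k ] (f i ∸ c)   ≡⟨ ∑-distrib-+ (λ _ → c) (λ i → f i ∸ c) ⟨
  ∑[ i < k ] (c + (f i ∸ c))            ≡⟨ sum-cong-≗ (λ i → m+[n∸m]≡n (c≤f i)) ⟩
  sum f                                 ∎
  where open ≡-Reasoning

dim-minimal : ∀ {H d} → IsAdjDim H d → ∀ S → IsAdjGen H S → d ≤ ∣ S ∣
dim-minimal (S₀ , (_ , S₀-min) , ∣S₀∣≡d) S S-gen = subst (_≤ ∣ S ∣) ∣S₀∣≡d (S₀-min S S-gen)

basis-size : ∀ {H d} → IsAdjDim H d → ∀ B → IsAdjBasis H B → ∣ B ∣ ≡ d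
basis-size dim@(S₀ , (S₀-gen , _) , ∣S₀∣≡d) B (B-gen , B-min) =
  ≤-antisym (subst (∣ B ∣ ≤_) ∣S₀∣≡d (B-min S₀ S₀-gen)) (dim-minimal dim B B-gen)

dominating-nonempty : ∀ {H} D → IsDominating H D → Vertex H → ∃ λ b → b ∈ D
dominating-nonempty D D-dom x with D-dom x
... | inj₁ x∈D            = x , x∈D
... | inj₂ (u , u∈D , _)  = u , u∈D

module CoronaModel (G H : Graph) where
  n m : ℕ
  n = order G
  m = order H

  C : Graph
  C = corona G H

  Vtx : Set
  Vtx = Fin n ⊎ (Fin n × Fin m)

  encode : Vtx → Vertex C
  encode (inj₁ i)       = i ↑ˡ (n * m)
  encode (inj₂ (i , x)) = n ↑ʳ combine i x

  decode : Vertex C → Vtx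
  decode v = [ inj₁ , (λ p → inj₂ (remQuot {n} m p)) ]′ (splitAt n v)

  decode-encode : ∀ X → decode (encode X) ≡ X
  decode-encode (inj₁ i)
    rewrite splitAt-↑ˡ n i (n * m) = refl
  decode-encode (inj₂ (i , x))
    rewrite splitAt-↑ʳ n (n * m) (combine i x) | remQuot-combine {n} {m} i x = refl

  encode-decode : ∀ v → encode (decode v) ≡ v
  encode-decode v with splitAt n v in eq
  ... | inj₁ i = trans (cong (join n (n * m)) (sym eq)) (join-splitAt n (n * m) v)
  ... | inj₂ p = trans (cong (n ↑ʳ_) (combine-remQuot {n} m p))
                       (trans (cong (join n (n * m)) (sym eq)) (join-splitAt n (n * m) v))

  encode-injective : ∀ {X Y} → encode X ≡ encode Y → X ≡ Y
  encode-injective {X} {Y} e = trans (sym (decode-encode X)) (trans (cong decode e) (decode-encode Y))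

  decode-injective : ∀ {u v} → decode u ≡ decode v → u ≡ v
  decode-injective {u} {v} e = trans (sym (encode-decode u)) (trans (cong encode e) (encode-decode v))

  A : Vtx → Vtx → Bool
  A (inj₁ i)       (inj₁ j)       = adj G i j
  A (inj₁ i)       (inj₂ (j , y)) = ⌊ i ≟ j ⌋
  A (inj₂ (i , x)) (inj₁ j)       = ⌊ i ≟ j ⌋
  A (inj₂ (i , x)) (inj₂ (j , y)) = ⌊ i ≟ j ⌋ ∧ adj H x y

  -- Both sides are given by the same case split, so this holds by computation.
  adj-corona : ∀ u v → adj C u v ≡ A (decode u) (decode v)
  adj-corona u v with splitAt n u | splitAt n v
  ... | inj₁ i | inj₁ j = refl
  ... | inj₁ i | inj₂ q = refl
  ... | inj₂ p | inj₁ j = refl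
  ... | inj₂ p | inj₂ q = refl

  members : Subset (order C) → Vtx → Bool
  members T X = lookup T (encode X)

  fromPredicate : (Vtx → Bool) → Subset (order C)
  fromPredicate f = tabulate (f ∘ decode)

  members-fromPredicate : ∀ f X → members (fromPredicate f) X ≡ f X
  members-fromPredicate f X = trans (lookup∘tabulate (f ∘ decode) (encode X)) (cong f (decode-encode X))

  size-corona : ∀ T → ∣ T ∣ ≡
    count (λ i → members T (inj₁ i)) + ∑[ i < n ] count (λ x → members T (inj₂ (i , x)))
  size-corona T = begin
    ∣ T ∣                                                    ≡⟨ size-as-count T ⟩
    count (lookup T)                                         ≡⟨ sum-↑ n _ ⟩
    count (λ i → members T (inj₁ i)) + count (lookup T ∘ (n ↑ʳ_))
      ≡⟨ cong (count (λ i → members T (inj₁ i)) +_) (sum-combine n _) ⟩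
    count (λ i → members T (inj₁ i)) + ∑[ i < n ] count (λ x → members T (inj₂ (i , x))) ∎
    where open ≡-Reasoning

  adj-encodeʳ : ∀ u Y → adj C u (encode Y) ≡ A (decode u) Y
  adj-encodeʳ u Y = trans (adj-corona u (encode Y)) (cong (A (decode u)) (decode-encode Y))

  adj-encodeˡ : ∀ X v → adj C (encode X) v ≡ A X (decode v)
  adj-encodeˡ X v = trans (adj-corona (encode X) v) (cong (λ Z → A Z (decode v)) (decode-encode X))

  Resolving : (Vtx → Bool) → Set
  Resolving f = ∀ X Y → X ≢ Y → f X ≡ false → f Y ≡ false →
    ∃ λ Z → f Z ≡ true × A Z X ≢ A Z Y

  generator⇒resolving : ∀ T → IsAdjGen C T → Resolving (members T)
  generator⇒resolving T T-gen X Y X≢Y X∉T Y∉T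
    with T-gen (encode X) (encode Y) (X≢Y ∘ encode-injective) (false⇒∉ X∉T) (false⇒∉ Y∉T)
  ... | s , s∈T , s-distinguishes =
    decode s , trans (cong (lookup T) (encode-decode s)) ([]=⇒lookup s∈T) ,
    λ e → s-distinguishes (trans (adj-encodeʳ s X) (trans e (sym (adj-encodeʳ s Y))))

  resolving⇒generator : ∀ f → Resolving f → IsAdjGen C (fromPredicate f)
  resolving⇒generator f f-res u v u≢v u∉ v∉
    with f-res (decode u) (decode v) (u≢v ∘ decode-injective) (outside u∉) (outside v∉)
    where
    outside : ∀ {w} → w ∉ fromPredicate f → f (decode w) ≡ false
    outside {w} w∉ = trans (sym (lookup∘tabulate (f ∘ decode) w)) (∉⇒false w∉)
  ... | Z , fZ , Z-distinguishes =
    encode Z , true⇒∈ (trans (members-fromPredicate f Z) fZ) ,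
    λ e → Z-distinguishes (trans (sym (adj-encodeˡ Z u)) (trans e (adj-encodeˡ Z v)))

module LowerBound (G H : Graph) (H-sym : ∀ x y → adj H x y ≡ adj H y x)
  {d g : ℕ} (d-minimal : ∀ S → IsAdjGen H S → d ≤ ∣ S ∣)
  (g-minimal : ∀ D → IsDominating G D → g ≤ ∣ D ∣)
  (common-neighbour : ∀ S → IsAdjBasis H S → ∃ λ v → v ∉ S × (∀ s → s ∈ S → Edge H v s))
  (T : Subset (order (corona G H))) (T-gen : IsAdjGen (corona G H) T) where
  open CoronaModel G H

  t : Vtx → Bool
  t = members T

  t-resolving : Resolving t
  t-resolving = generator⇒resolving T T-gen

  copy : Fin n → Subset m
  copy i = tabulate (λ x → t (inj₂ (i , x)))

  copy-size : Fin n → ℕ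
  copy-size i = ∣ copy i ∣

  -- Only vertices of H_i distinguish two vertices of H_i, so copy i generates H.
  copy-generator : ∀ i → IsAdjGen H (copy i)
  copy-generator i x y x≢y x∉ y∉
    with t-resolving (inj₂ (i , x)) (inj₂ (i , y)) (λ { refl → x≢y refl })
                     (in-copy x x∉) (in-copy y y∉)
    where
    in-copy : ∀ z → z ∉ copy i → t (inj₂ (i , z)) ≡ false
    in-copy z z∉ = trans (sym (lookup∘tabulate _ z)) (∉⇒false z∉)
  ... | inj₁ j , _ , distinguishes = ⊥-elim (distinguishes refl)
  ... | inj₂ (j , z) , tZ , distinguishes with j ≟ i
  ...   | no _     = ⊥-elim (distinguishes refl)
  ...   | yes refl = z , true⇒∈ (trans (lookup∘tabulate _ z) tZ) , distinguishes

  d≤copy-size : ∀ i → d ≤ copy-size i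
  d≤copy-size i = d-minimal (copy i) (copy-generator i)

  copy-basis : ∀ i → copy-size i ≤ d → IsAdjBasis H (copy i)
  copy-basis i ≤d = copy-generator i , λ S S-gen → ≤-trans ≤d (d-minimal S S-gen)

  -- Key step: if v_i ∉ T and copy i is a basis of H, let z be a vertex of H_i
  -- adjacent to all of copy i.  Whatever distinguishes v_i from z must be a
  -- G-neighbour of v_i lying in T.
  neighbour-in-T : ∀ i → t (inj₁ i) ≡ false → IsAdjBasis H (copy i) →
    ∃ λ j → t (inj₁ j) ≡ true × Edge G j i
  neighbour-in-T i vᵢ∉T basis with common-neighbour (copy i) basis
  ... | z , z∉ , z-adjacent
    with t-resolving (inj₁ i) (inj₂ (i , z)) (λ ()) vᵢ∉T
                     (trans (sym (lookup∘tabulate _ z)) (∉⇒false z∉))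
  ... | inj₁ j , vⱼ∈T , distinguishes with j ≟ i
  ...   | yes refl = ⊥-elim (true≢false vⱼ∈T vᵢ∉T refl)
  ...   | no _     = j , vⱼ∈T , ¬-not distinguishes
  neighbour-in-T i vᵢ∉T basis | z , z∉ , z-adjacent
    | inj₂ (j , w) , w∈T , distinguishes with j ≟ i
  ...   | no _     = ⊥-elim (distinguishes refl)
  ...   | yes refl = ⊥-elim (distinguishes (sym w~z))
    where
    w~z : adj H w z ≡ true
    w~z = trans (H-sym w z) (z-adjacent w (true⇒∈ (trans (lookup∘tabulate _ w) w∈T)))

  selected : Fin n → Bool
  selected i = t (inj₁ i) ∨ ⌊ d <? copy-size i ⌋

  D′ : Subset n
  D′ = tabulate selected

  selected-if-in-T : ∀ {i} → t (inj₁ i) ≡ true → i ∈ D′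
  selected-if-in-T {i} vᵢ∈T = true⇒∈ (trans (lookup∘tabulate selected i) (cong (_∨ ⌊ d <? copy-size i ⌋) vᵢ∈T))

  selected-if-large : ∀ {i} → d < copy-size i → i ∈ D′
  selected-if-large {i} large = true⇒∈ (begin
    lookup D′ i                         ≡⟨ lookup∘tabulate selected i ⟩
    t (inj₁ i) ∨ ⌊ d <? copy-size i ⌋   ≡⟨ cong (t (inj₁ i) ∨_) (holds (d <? copy-size i) large) ⟩
    t (inj₁ i) ∨ true                   ≡⟨ ∨-zeroʳ (t (inj₁ i)) ⟩
    true                                ∎)
    where open ≡-Reasoning

  dominated-outside-T : ∀ i → t (inj₁ i) ≡ false → Dec (d < copy-size i) →
    i ∈ D′ ⊎ (∃ λ j → j ∈ D′ × Edge G j i)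
  dominated-outside-T i vᵢ∉T (yes large) = inj₁ (selected-if-large large)
  dominated-outside-T i vᵢ∉T (no ¬large) =
    inj₂ (neighbour-selected (neighbour-in-T i vᵢ∉T (copy-basis i (≮⇒≥ ¬large))))
    where
    neighbour-selected : (∃ λ j → t (inj₁ j) ≡ true × Edge G j i) → ∃ λ j → j ∈ D′ × Edge G j i
    neighbour-selected (j , vⱼ∈T , edge) = j , selected-if-in-T vⱼ∈T , edge

  D′-dominating : IsDominating G D′
  D′-dominating i with t (inj₁ i) in vᵢ∈?T
  ... | true  = inj₁ (selected-if-in-T vᵢ∈?T)
  ... | false = dominated-outside-T i vᵢ∈?T (d <? copy-size i)

  selected-paid : ∀ i → indicator (selected i) ≤ indicator (t (inj₁ i)) + (copy-size i ∸ d)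
  selected-paid i with t (inj₁ i)
  ... | true = s≤s z≤n
  ... | false with d <? copy-size i
  ...   | yes large = m<n⇒0<n∸m large
  ...   | no _      = z≤n

  lower-bound : n * d + g ≤ ∣ T ∣
  lower-bound = begin
    n * d + g                                     ≤⟨ +-monoʳ-≤ (n * d) (g-minimal D′ D′-dominating) ⟩
    n * d + ∣ D′ ∣                                ≡⟨ cong (n * d +_) (size-tabulate selected) ⟩
    n * d + count selected                        ≤⟨ +-monoʳ-≤ (n * d) (sum-mono selected-paid) ⟩
    n * d + ∑[ i < n ] (inT i + excess i)         ≡⟨ cong (n * d +_) (∑-distrib-+ inT excess) ⟩
    n * d + (sum inT + sum excess)                ≡⟨ x∙yz≈y∙xz +-commutativeSemigroup (n * d) (sum inT) (sum excess) ⟩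
    sum inT + (n * d + sum excess)                ≡⟨ cong (sum inT +_) (sum-excess d copy-size d≤copy-size) ⟩
    sum inT + sum copy-size                       ≡⟨ cong (sum inT +_) (sum-cong-≗ (λ i → size-tabulate (λ x → t (inj₂ (i , x))))) ⟩
    sum inT + ∑[ i < n ] count (λ x → t (inj₂ (i , x)))  ≡⟨ size-corona T ⟨
    ∣ T ∣                                         ∎
    where
    open ≤-Reasoning
    inT excess : Fin n → ℕ
    inT i    = indicator (t (inj₁ i))
    excess i = copy-size i ∸ d

module UpperBound (G H : Graph)
  (B : Subset (order H)) (B-gen : IsAdjGen H B) (B-dom : IsDominating H B)
  (b₀ : Vertex H) (b₀∈B : b₀ ∈ B)
  (D : Subset (order G)) (D-dom : IsDominating G D) where
  open CoronaModel G H

  w : Vtx → Bool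
  w (inj₁ i)       = lookup D i
  w (inj₂ (i , x)) = lookup B x

  W : Subset (order C)
  W = fromPredicate w

  W-size : ∣ W ∣ ≡ ∣ D ∣ + n * ∣ B ∣
  W-size = begin
    ∣ W ∣                                                            ≡⟨ size-corona W ⟩
    count (λ i → members W (inj₁ i)) + ∑[ i < n ] count (λ x → members W (inj₂ (i , x)))
      ≡⟨ cong₂ _+_ (count-cong (members-fromPredicate w ∘ inj₁))
                   (sum-cong-≗ (λ i → count-cong (λ x → members-fromPredicate w (inj₂ (i , x))))) ⟩
    count (lookup D) + ∑[ i < n ] count (lookup B)
      ≡⟨ cong₂ _+_ (size-as-count D) (sum-cong-≗ {n} (λ _ → size-as-count B)) ⟨
    ∣ D ∣ + ∑[ i < n ] ∣ B ∣                                         ≡⟨ cong (∣ D ∣ +_) (sum-const n ∣ B ∣) ⟩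
    ∣ D ∣ + n * ∣ B ∣                                                ∎
    where open ≡-Reasoning

  same : ∀ {k} (i : Fin k) → ⌊ i ≟ i ⌋ ≡ true
  same i = holds (i ≟ i) refl

  -- v_i ∉ W and (j , y) ∉ W are distinguished: by a G-neighbour of v_i in D if
  -- i = j, and by a B-neighbour of y in H_j otherwise.
  vertex-vs-copy : ∀ i j y → w (inj₁ i) ≡ false → w (inj₂ (j , y)) ≡ false →
    ∃ λ Z → w Z ≡ true × A Z (inj₁ i) ≢ A Z (inj₂ (j , y))
  vertex-vs-copy i j y vᵢ∉W y∉B with i ≟ j
  ... | yes refl with D-dom i
  ...   | inj₁ i∈D = ⊥-elim (false⇒∉ vᵢ∉W i∈D)
  ...   | inj₂ (k , k∈D , edge) =
    inj₁ k , []=⇒lookup k∈D , true≢false edge (fails (k ≟ i) k≢i)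
    where
    k≢i : k ≢ i
    k≢i refl = false⇒∉ vᵢ∉W k∈D
  vertex-vs-copy i j y vᵢ∉W y∉B | no i≢j with B-dom y
  ...   | inj₁ y∈B = ⊥-elim (false⇒∉ y∉B y∈B)
  ...   | inj₂ (b , b∈B , edge) =
    inj₂ (j , b) , []=⇒lookup b∈B ,
    false≢true (fails (j ≟ i) (i≢j ∘ sym)) (cong₂ _∧_ (same j) edge)

  -- Two vertices of copies outside W: inside one copy B resolves them, and across
  -- copies a B-neighbour of the first one sees only the first.
  copy-vs-copy : ∀ i x j y → (i , x) ≢ (j , y) →
    w (inj₂ (i , x)) ≡ false → w (inj₂ (j , y)) ≡ false →
    ∃ λ Z → w Z ≡ true × A Z (inj₂ (i , x)) ≢ A Z (inj₂ (j , y))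
  copy-vs-copy i x j y ix≢jy x∉B y∉B with i ≟ j
  ... | yes refl with B-gen x y (λ { refl → ix≢jy refl }) (false⇒∉ x∉B) (false⇒∉ y∉B)
  ...   | b , b∈B , b-distinguishes =
    inj₂ (i , b) , []=⇒lookup b∈B ,
    λ e → b-distinguishes (trans (sym (cong (_∧ _) (same i))) (trans e (cong (_∧ _) (same i))))
  copy-vs-copy i x j y ix≢jy x∉B y∉B | no i≢j with B-dom x
  ...   | inj₁ x∈B = ⊥-elim (false⇒∉ x∉B x∈B)
  ...   | inj₂ (b , b∈B , edge) =
    inj₂ (i , b) , []=⇒lookup b∈B ,
    true≢false (cong₂ _∧_ (same i) edge) (cong (_∧ _) (fails (i ≟ j) i≢j))

  -- Two vertices v_i ≠ v_j outside W are distinguished by a vertex of B inside H_i.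
  W-resolving : Resolving w
  W-resolving (inj₁ i) (inj₁ j) vᵢ≢vⱼ _ _ =
    inj₂ (i , b₀) , []=⇒lookup b₀∈B ,
    true≢false (same i) (fails (i ≟ j) (vᵢ≢vⱼ ∘ cong inj₁))
  W-resolving (inj₁ i) (inj₂ (j , y)) _ vᵢ∉W y∉W = vertex-vs-copy i j y vᵢ∉W y∉W
  W-resolving (inj₂ (j , y)) (inj₁ i) _ y∉W vᵢ∉W with vertex-vs-copy i j y vᵢ∉W y∉W
  ... | Z , Z∈W , distinguishes = Z , Z∈W , λ e → distinguishes (sym e)
  W-resolving (inj₂ (i , x)) (inj₂ (j , y)) X≢Y x∉W y∉W = copy-vs-copy i x j y (X≢Y ∘ cong inj₂) x∉W y∉W

  W-generator : IsAdjGen C W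
  W-generator = resolving⇒generator w W-resolving

theorem8 : (G H : Graph) → IsSimple G → IsSimple H →
    Connected G → 2 ≤ order G → 2 ≤ order H →
    (Σ (Subset (order H)) λ S → IsAdjBasis H S × IsDominating H S) →
    (∀ S → IsAdjBasis H S → ∃ λ v → v ∉ S × (∀ s → s ∈ S → Edge H v s)) →
    ∀ d g → IsAdjDim H d → IsDomNumber G g →
    IsAdjDim (corona G H) (order G * d + g)
theorem8 G H _ (H-sym , _) _ _ 2≤m (B , B-basis , B-dom) common-neighbour d g
         dim ((D , D-dom , ∣D∣≡g) , g-minimal) =
  W , (W-generator , λ T T-gen → subst (_≤ ∣ T ∣) (sym W-size′) (lower-bound T T-gen)) , W-size′
  where
  b₀∈B : ∃ λ b → b ∈ B
  b₀∈B = dominating-nonempty B B-dom (fromℕ< {0} (≤-trans (s≤s z≤n) 2≤m))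
  open UpperBound G H B (proj₁ B-basis) B-dom (proj₁ b₀∈B) (proj₂ b₀∈B) D D-dom
  open LowerBound G H H-sym (dim-minimal dim) g-minimal common-neighbour
    using (lower-bound)
  W-size′ : ∣ W ∣ ≡ order G * d + g
  W-size′ = begin
    ∣ W ∣                  ≡⟨ W-size ⟩
    ∣ D ∣ + order G * ∣ B ∣  ≡⟨ cong₂ (λ a b → a + order G * b) ∣D∣≡g (basis-size dim B B-basis) ⟩
    g + order G * d        ≡⟨ +-comm g _ ⟩
    order G * d + g        ∎
    where open ≡-Reasoning
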